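{- Let $m\ge 1$ and $\alpha,\beta^1,\dots,\beta^m\in\mathrm{ord}$. Then $\alpha<\beta^1,\dots,\beta^m$ holds if and only if $\alpha<\sup(\beta^1,\dots,\beta^m)$ holds. Similarly, $\alpha\le\beta^1,\dots,\beta^m$ holds if and only if $\alpha\le\sup(\beta^1,\dots,\beta^m)$ holds.
   Context: The setting is constructive (intuitionistic logic). Let $\mathfrak F$ be a set of index sets containing $\mathbb N$ and every $\mathbb N_k=\{n\in\mathbb N:n<k\}$ ($k\ge0$), such that any finitely enumerated subset (image of a map $\mathbb N_k\to J$) of an element $J\in\mathfrak F$ is isomorphic to an element of $\mathfrak F$, the set of finitely enumerated subsets of any $J\in\mathfrak F$ is isomorphic to an element of $\mathfrak F$, and $\mathfrak F$ is closed under disjoint unions $\sum_{i\in I}J_i$ with $I,J_i\in\mathfrak F$. The set $\mathrm{ord}=\mathrm{ord}_{\mathfrak F}$ of (names of) ordinals is defined inductively: it has a distinguished element $\underline 0$, and for every $I\in\mathfrak F$ and every family $(\alpha_i)_{i\in I}$ in $\mathrm{ord}$ there is an element $\mathrm S(\alpha_i)_{i\in I}\in\mathrm{ord}$; $\mathrm{ord}^*$ denotes the set of elements of this second kind. For $\alpha=\mathrm S(\alpha_i)_{i\in I}$ write $\mathrm{In}_\alpha=I$; by convention $\mathrm{In}_{\underline 0}=\mathbb N_0=\emptyset$. For a finite list $F$ of elements of $\mathrm{In}_\alpha$ (written $F\subseteq_f\mathrm{In}_\alpha$), $\alpha_F$ denotes the list of the $\alpha_i$, $i\in F$. Two relations between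 an element of $\mathrm{ord}$ and a nonempty finite list of elements of $\mathrm{ord}$ are defined by simultaneous induction ($m\ge1$): $\alpha\le\beta^1,\dots,\beta^m$ means $\alpha_i<\beta^1,\dots,\beta^m$ for all $i\in\mathrm{In}_\alpha$; $\alpha<\beta^1,\dots,\beta^m$ means there exist $F_1\subseteq_f\mathrm{In}_{\beta^1},\dots,F_m\subseteq_f\mathrm{In}_{\beta^m}$, not all empty, such that $\alpha\le\beta^1_{F_1},\dots,\beta^m_{F_m}$ (the concatenated list). The supremum of a family $(\alpha^j)_{j\in J}$ in $\mathrm{ord}^*$ with $J\in\mathfrak F$, where $\alpha^j=\mathrm S((\alpha^j)_i)_{i\in I_j}$, is $\sup(\alpha^j)_{j\in J}=\mathrm S(\varepsilon_k)_{k\in K}$, where $K$ is the disjoint union of the $I_j$ and $\varepsilon_k=(\alpha^j)_i$ when $k$ is the image of $i\in I_j$. For a finite family in $\mathrm{ord}$, $\sup(\alpha^1,\dots,\alpha^r)$ is $\underline0$ if all $\alpha^k$ are $\underline 0$, and otherwise the sup (as just defined) of those $\alpha^k$ that lie in $\mathrm{ord}^*$. -}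

module Defs where

open import Data.Nat using (ℕ)
open import Data.Fin using (Fin)
open import Data.List using (List; []; _∷_; _++_; map; length; lookup)
open import Data.List.Membership.Propositional using (_∈_)
open import Data.Product using (Σ; _×_; _,_; proj₁; proj₂; ∃)
open import Data.Sum using (_⊎_)
open import Data.Unit using (⊤)
open import Data.Empty using (⊥)
open import Function using (_∘_; _⇔_)
open import Function.Bundles using (_↔_; Inverse)
open import Function.Definitions using (Injective)
open import Relation.Binary.PropositionalEquality using (_≡_)
open import Relation.Nullary using (¬_)

SameImage : {A : Set} → List A → List A → Set
SameImage l l' = ∀ x → (x ∈ l) ⇔ (x ∈ l')

-- The set 𝔉 of index sets, given as a universe of codes with decoding El,
-- together with the closure properties assumed in the paper.
record IndexFamily : Set₁ where
  field
    Code : Set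
    El   : Code → Set
    natCode : Code
    natIso  : El natCode ↔ ℕ
    finCode : ℕ → Code
    finIso  : ∀ k → El (finCode k) ↔ Fin k
    finSubset : ∀ (J : Code) (k : ℕ) (e : Fin k → El J) →
      Σ Code λ K → Σ (El K → El J) λ g →
        Injective _≡_ _≡_ g × (∀ x → (∃ λ y → g y ≡ x) ⇔ (∃ λ i → e i ≡ x))
    -- the set of finitely enumerated subsets of J ∈ 𝔉 is isomorphic to an
    -- element K of 𝔉 (finitely enumerated subsets represented by lists,
    -- identified when they have the same image)
    finSubsets : ∀ (J : Code) →
      Σ Code λ K → Σ (El K → List (El J)) λ g →
        (∀ y y' → SameImage (g y) (g y') → y ≡ y') ×
        (∀ (l : List (El J)) → ∃ λ y → SameImage (g y) l)
    sigmaCode : (I : Code) → (El I → Code) → Code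
    sigmaIso  : ∀ I (J : El I → Code) → El (sigmaCode I J) ↔ Σ (El I) (El ∘ J)

module _ (𝔉 : IndexFamily) where
  open IndexFamily 𝔉

  data Ord : Set where
    0̲ : Ord
    S  : (I : Code) → (El I → Ord) → Ord

  In : Ord → Set
  In 0̲ = Fin 0
  In (S I f) = El I

  sub : (α : Ord) → In α → Ord
  sub 0̲ ()
  sub (S I f) i = f i

  Sel : List Ord → Set
  Sel [] = ⊤
  Sel (β ∷ βs) = List (In β) × Sel βs

  picked : (βs : List Ord) → Sel βs → List Ord
  picked [] _ = []
  picked (β ∷ βs) (F , Fs) = map (sub β) F ++ picked βs Fs

  NotAllEmpty : (βs : List Ord) → Sel βs → Set
  NotAllEmpty [] _ = ⊥
  NotAllEmpty (β ∷ βs) (F , Fs) = ¬ (F ≡ []) ⊎ NotAllEmpty βs Fs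

  mutual
    _≼_ : Ord → List Ord → Set
    0̲ ≼ βs = ⊤                       -- vacuous: In_0̲ is empty
    S I f ≼ βs = (i : El I) → f i ≺ βs

    _≺_ : Ord → List Ord → Set
    α ≺ βs = Σ (Sel βs) λ Fs → NotAllEmpty βs Fs × (α ≼ picked βs Fs)

  Star : Set
  Star = Σ Code λ I → El I → Ord

  supFam : (J : Code) → (El J → Star) → Ord
  supFam J fam = S (sigmaCode J (proj₁ ∘ fam))
    (λ k → let p = Inverse.to (sigmaIso J (proj₁ ∘ fam)) k
           in proj₂ (fam (proj₁ p)) (proj₂ p))

  stars : List Ord → List Star
  stars [] = []
  stars (0̲ ∷ αs) = stars αs
  stars (S I f ∷ αs) = (I , f) ∷ stars αs

  supStars : List Star → Ord
  supStars [] = 0̲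
  supStars cs@(_ ∷ _) =
    supFam (finCode (length cs)) (λ j → lookup cs (Inverse.to (finIso (length cs)) j))

  supList : List Ord → Ord
  supList αs = supStars (stars αs)

{-# OPTIONS --safe #-}
module Submission where

-- Both relations depend on the list β¹,…,βᵐ only through its set of children
-- {βᵏᵢ : i ∈ In_{βᵏ}}: every list picked by a selection F₁,…,Fₘ consists of such
-- children, every finite list of children is contained in a picked one, and a selection
-- is not all empty iff it picks something. So by induction on α any inclusion of
-- children sets transports both relations. The children of sup(β¹,…,βᵐ) are by
-- construction those of the βᵏ (the βᵏ equal to 0̲ have none).

open import Defs
open import Data.Empty using (⊥-elim)
open import Data.Fin using (Fin)
open import Data.List using (List; []; _∷_; [_]; _++_; map; length; lookup)
open import Data.List.Membership.Propositional using (_∈_; lose)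
open import Data.List.Membership.Propositional.Properties using (∈-map⁻; ∈-++⁺ʳ; ∈-++⁻; ∈-lookup)
open import Data.List.Relation.Binary.Subset.Propositional using (_⊆_)
open import Data.List.Relation.Binary.Subset.Propositional.Properties using (Any-resp-⊆; ++⁺; map⁺; xs⊆xs++ys; xs⊆ys++xs)
open import Data.List.Relation.Unary.Any as Any using (Any; here; there)
open import Data.List.Relation.Unary.Any.Properties using (lookup-index; singleton⁺; singleton⁻)
open import Data.Product using (Σ; ∃; _×_; _,_; proj₁)
open import Data.Product.Algebra using (Σ-assoc-alt)
open import Data.Product.Function.Dependent.Propositional using (Σ-⇔)
open import Data.Sum using (inj₁; inj₂)
open import Data.Unit using (tt)
open import Function using (_∘_; _⇔_; mk⇔; Equivalence)
open import Function.Construct.Composition using (_⇔-∘_)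
open import Function.Construct.Identity using (⇔-id)
open import Function.Construct.Symmetry using (⇔-sym)
open import Function.Properties.Inverse using (↔⇒↠; ↔⇒⇔)
open import Relation.Binary.PropositionalEquality using (_≡_; refl; sym)

Any⇔∃-lookup : {A : Set} {P : A → Set} (xs : List A) → Any P xs ⇔ Σ (Fin (length xs)) (P ∘ lookup xs)
Any⇔∃-lookup xs = mk⇔ (λ p → Any.index p , lookup-index p) (λ (i , p) → lose (∈-lookup i) p)

module _ (𝔉 : IndexFamily) where
  open IndexFamily 𝔉

  ChildOf : Ord 𝔉 → Ord 𝔉 → Set
  ChildOf x β = Σ (In 𝔉 β) λ i → sub 𝔉 β i ≡ x

  ChildOfAny : Ord 𝔉 → List (Ord 𝔉) → Set
  ChildOfAny x = Any (ChildOf x)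

  emptySel : ∀ βs → Sel 𝔉 βs
  emptySel []       = tt
  emptySel (β ∷ βs) = [] , emptySel βs

  unionSel : ∀ βs → Sel 𝔉 βs → Sel 𝔉 βs → Sel 𝔉 βs
  unionSel []       _        _        = tt
  unionSel (β ∷ βs) (F , Fs) (G , Gs) = F ++ G , unionSel βs Fs Gs

  ∈-picked⁻ : ∀ βs Fs {x} → x ∈ picked 𝔉 βs Fs → ChildOfAny x βs
  ∈-picked⁻ (β ∷ βs) (F , Fs) x∈ with ∈-++⁻ (map (sub 𝔉 β) F) x∈
  ... | inj₂ x∈Fs = there (∈-picked⁻ βs Fs x∈Fs)
  ... | inj₁ x∈F with ∈-map⁻ (sub 𝔉 β) x∈F
  ...   | i , _ , x≡ = here (i , sym x≡)

  picked-unionSelˡ : ∀ βs Fs Gs → picked 𝔉 βs Fs ⊆ picked 𝔉 βs (unionSel βs Fs Gs)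
  picked-unionSelˡ []       _        _        = λ ()
  picked-unionSelˡ (β ∷ βs) (F , Fs) (G , Gs) =
    ++⁺ (map⁺ (sub 𝔉 β) (xs⊆xs++ys F G)) (picked-unionSelˡ βs Fs Gs)

  picked-unionSelʳ : ∀ βs Fs Gs → picked 𝔉 βs Gs ⊆ picked 𝔉 βs (unionSel βs Fs Gs)
  picked-unionSelʳ []       _        _        = λ ()
  picked-unionSelʳ (β ∷ βs) (F , Fs) (G , Gs) =
    ++⁺ (map⁺ (sub 𝔉 β) (xs⊆ys++xs G F)) (picked-unionSelʳ βs Fs Gs)

  select-child : ∀ βs {x} → ChildOfAny x βs → Σ (Sel 𝔉 βs) λ Fs → x ∈ picked 𝔉 βs Fs
  select-child (β ∷ βs) (here (i , refl)) = (i ∷ [] , emptySel βs) , here refl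
  select-child (β ∷ βs) (there x∈) =
    let Fs , x∈Fs = select-child βs x∈ in ([] , Fs) , x∈Fs

  select-children : ∀ βs γs → (∀ {x} → x ∈ γs → ChildOfAny x βs) →
    Σ (Sel 𝔉 βs) λ Fs → γs ⊆ picked 𝔉 βs Fs
  select-children βs []       _  = emptySel βs , λ ()
  select-children βs (γ ∷ γs) ch =
    let Fs , γ∈Fs  = select-child βs (ch (here refl))
        Gs , γs⊆Gs = select-children βs γs (ch ∘ there)
    in unionSel βs Fs Gs , λ { (here refl) → picked-unionSelˡ βs Fs Gs γ∈Fs
                             ; (there x∈)  → picked-unionSelʳ βs Fs Gs (γs⊆Gs x∈) }

  NotAllEmpty⇒∃∈picked : ∀ βs Fs → NotAllEmpty 𝔉 βs Fs → ∃ λ x → x ∈ picked 𝔉 βs Fs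
  NotAllEmpty⇒∃∈picked (β ∷ βs) ([] , Fs)    (inj₁ F≢[]) = ⊥-elim (F≢[] refl)
  NotAllEmpty⇒∃∈picked (β ∷ βs) (i ∷ F , Fs) (inj₁ _)    = sub 𝔉 β i , here refl
  NotAllEmpty⇒∃∈picked (β ∷ βs) (F , Fs)     (inj₂ nae)  =
    let x , x∈Fs = NotAllEmpty⇒∃∈picked βs Fs nae in x , ∈-++⁺ʳ (map (sub 𝔉 β) F) x∈Fs

  ∈picked⇒NotAllEmpty : ∀ βs Fs {x} → x ∈ picked 𝔉 βs Fs → NotAllEmpty 𝔉 βs Fs
  ∈picked⇒NotAllEmpty (β ∷ βs) ([] , Fs)    x∈ = inj₂ (∈picked⇒NotAllEmpty βs Fs x∈)
  ∈picked⇒NotAllEmpty (β ∷ βs) (i ∷ F , Fs) _  = inj₁ λ ()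

  mutual
    ≼-transport : ∀ {βs γs} → (∀ {x} → ChildOfAny x βs → ChildOfAny x γs) →
      ∀ α → _≼_ 𝔉 α βs → _≼_ 𝔉 α γs
    ≼-transport t 0̲       _   = tt
    ≼-transport t (S I f) α≼ i = ≺-transport t (f i) (α≼ i)

    ≺-transport : ∀ {βs γs} → (∀ {x} → ChildOfAny x βs → ChildOfAny x γs) →
      ∀ α → _≺_ 𝔉 α βs → _≺_ 𝔉 α γs
    ≺-transport {βs} {γs} t α (Fs , nae , α≼) =
      let x , x∈Fs = NotAllEmpty⇒∃∈picked βs Fs nae
          Gs , Fs⊆Gs = select-children γs (picked 𝔉 βs Fs) (t ∘ ∈-picked⁻ βs Fs)
      in Gs , ∈picked⇒NotAllEmpty γs Gs (Fs⊆Gs x∈Fs) , ≼-transport (Any-resp-⊆ Fs⊆Gs) α α≼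

  ChildOfStar : Ord 𝔉 → Star 𝔉 → Set
  ChildOfStar x (I , f) = Σ (El I) λ i → f i ≡ x

  ChildOfAny⇔Any-stars : ∀ {x} βs → ChildOfAny x βs ⇔ Any (ChildOfStar x) (stars 𝔉 βs)
  ChildOfAny⇔Any-stars {x} βs = mk⇔ (to βs) (from βs)
    where
      to : ∀ βs → ChildOfAny x βs → Any (ChildOfStar x) (stars 𝔉 βs)
      to (0̲     ∷ βs) (here (() , _))
      to (S I f ∷ βs) (here x∈)  = here x∈
      to (0̲     ∷ βs) (there x∈) = to βs x∈
      to (S I f ∷ βs) (there x∈) = there (to βs x∈)

      from : ∀ βs → Any (ChildOfStar x) (stars 𝔉 βs) → ChildOfAny x βs
      from (0̲     ∷ βs) x∈         = there (from βs x∈)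
      from (S I f ∷ βs) (here x∈)  = here x∈
      from (S I f ∷ βs) (there x∈) = there (from βs x∈)

  ChildOf-supFam : ∀ {x} J fam → ChildOf x (supFam 𝔉 J fam) ⇔ Σ (El J) (ChildOfStar x ∘ fam)
  ChildOf-supFam J fam = ↔⇒⇔ Σ-assoc-alt ⇔-∘ Σ-⇔ (↔⇒↠ (sigmaIso J (proj₁ ∘ fam))) (⇔-id _)

  ChildOf-supStars : ∀ {x} cs → ChildOf x (supStars 𝔉 cs) ⇔ Any (ChildOfStar x) cs
  ChildOf-supStars []         = mk⇔ (λ { (() , _) }) λ ()
  ChildOf-supStars cs@(_ ∷ _) =
    (⇔-sym (Any⇔∃-lookup cs) ⇔-∘ Σ-⇔ (↔⇒↠ (finIso (length cs))) (⇔-id _)) ⇔-∘ ChildOf-supFam _ _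

  ChildOf-supList : ∀ {x} βs → ChildOf x (supList 𝔉 βs) ⇔ ChildOfAny x βs
  ChildOf-supList βs =
    ⇔-sym (ChildOfAny⇔Any-stars βs) ⇔-∘ ChildOf-supStars (stars 𝔉 βs)

lemma3p7 : (𝔉 : IndexFamily) (α β : Ord 𝔉) (βs : List (Ord 𝔉)) →
    ((_≺_ 𝔉 α (β ∷ βs)) ⇔ (_≺_ 𝔉 α (supList 𝔉 (β ∷ βs) ∷ []))) ×
    ((_≼_ 𝔉 α (β ∷ βs)) ⇔ (_≼_ 𝔉 α (supList 𝔉 (β ∷ βs) ∷ [])))
lemma3p7 𝔉 α β βs =
  mk⇔ (≺-transport 𝔉 toSup α) (≺-transport 𝔉 fromSup α) ,
  mk⇔ (≼-transport 𝔉 toSup α) (≼-transport 𝔉 fromSup α)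
  where
    toSup : ∀ {x} → ChildOfAny 𝔉 x (β ∷ βs) → ChildOfAny 𝔉 x [ supList 𝔉 (β ∷ βs) ]
    toSup = singleton⁺ ∘ Equivalence.from (ChildOf-supList 𝔉 (β ∷ βs))

    fromSup : ∀ {x} → ChildOfAny 𝔉 x [ supList 𝔉 (β ∷ βs) ] → ChildOfAny 𝔉 x (β ∷ βs)
    fromSup = Equivalence.to (ChildOf-supList 𝔉 (β ∷ βs)) ∘ singleton⁻
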